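{- Let $X$ and $Y$ be simple graphs on the same number of vertices. Then $g(\mathsf{FS}(X,Y)) = 4$ if and only if either $X$ and $Y$ each have at least two disjoint edges, or $X$ and $Y$ both contain $K_3$ as a subgraph.
   Context: $\mathsf{FS}(X,Y)$ has as vertices all bijections $\sigma: V(X)\to V(Y)$, with $\sigma,\sigma'$ adjacent iff there is an edge $\{a,b\}\in E(X)$ with $\{\sigma(a),\sigma(b)\}\in E(Y)$, $\sigma'(a)=\sigma(b)$, $\sigma'(b)=\sigma(a)$ and $\sigma'=\sigma$ elsewhere. $g(G)$ denotes the girth (length of a shortest cycle, $\infty$ if none). -}

module Defs where

open import Data.Nat using (ℕ; zero; suc; _<_; _≤_)
open import Data.Fin using (Fin; zero; suc; inject₁; fromℕ)
open import Data.Bool using (Bool; true; false; T)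
open import Data.Product using (Σ; ∃; _×_; _,_; proj₁)
open import Relation.Binary.PropositionalEquality using (_≡_; _≢_)
open import Relation.Nullary using (¬_)
open import Function.Definitions using (Bijective)
open import Data.Empty using (⊥)

record SimpleGraph (n : ℕ) : Set where
  field
    E     : Fin n → Fin n → Bool
    sym   : ∀ a b → E a b ≡ E b a
    irrefl : ∀ a → E a a ≡ false

open SimpleGraph public

Edge : ∀ {n} → SimpleGraph n → Fin n → Fin n → Set
Edge X a b = T (E X a b)

HasTwoDisjointEdges : ∀ {n} → SimpleGraph n → Set
HasTwoDisjointEdges {n} X =
  Σ (Fin n) λ a → Σ (Fin n) λ b → Σ (Fin n) λ c → Σ (Fin n) λ d →
    Edge X a b × Edge X c d ×
    a ≢ c × a ≢ d × b ≢ c × b ≢ d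

ContainsK3 : ∀ {n} → SimpleGraph n → Set
ContainsK3 {n} X =
  Σ (Fin n) λ a → Σ (Fin n) λ b → Σ (Fin n) λ c →
    Edge X a b × Edge X b c × Edge X a c

record Graph : Set₁ where
  field
    V   : Set
    _≈_ : V → V → Set
    Adj : V → V → Set

-- A cycle of length suc m (≥ 3) in G: vertices f 0, …, f m, pairwise distinct,
-- with f i adjacent to f (i+1) and f m adjacent to f 0.
record Cycle (G : Graph) (m : ℕ) : Set where
  open Graph G
  field
    len≥3    : 2 ≤ m
    vtx      : Fin (suc m) → V
    distinct : ∀ i j → i ≢ j → ¬ (vtx i ≈ vtx j)
    step     : ∀ (i : Fin m) → Adj (vtx (inject₁ i)) (vtx (suc i))
    close    : Adj (vtx (fromℕ m)) (vtx zero)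

HasCycleOfLength : Graph → ℕ → Set
HasCycleOfLength G zero = ⊥
HasCycleOfLength G (suc m) = Cycle G m

GirthIs : Graph → ℕ → Set
GirthIs G k = HasCycleOfLength G k × (∀ j → j < k → ¬ HasCycleOfLength G j)

Bij : ℕ → Set
Bij n = Σ (Fin n → Fin n) (Bijective {A = Fin n} {B = Fin n} _≡_ _≡_)

FSAdj : ∀ {n} → SimpleGraph n → SimpleGraph n → Bij n → Bij n → Set
FSAdj {n} X Y (σ , _) (σ' , _) =
  Σ (Fin n) λ a → Σ (Fin n) λ b →
    Edge X a b × Edge Y (σ a) (σ b) ×
    σ' a ≡ σ b × σ' b ≡ σ a ×
    (∀ c → c ≢ a → c ≢ b → σ' c ≡ σ c)

FS : ∀ {n} → SimpleGraph n → SimpleGraph n → Graph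
FS {n} X Y = record
  { V   = Bij n
  ; _≈_ = λ s t → ∀ v → proj₁ s v ≡ proj₁ t v
  ; Adj = FSAdj X Y
  }

-- A step of FS(X,Y) changes a bijection at exactly two points. Two consecutive steps
-- σ – τ – ρ with ρ ≠ σ change it at three or more: either the two swapped edges are
-- disjoint, and then they give two disjoint edges in X and (read through σ) in Y, or they
-- share a vertex and ρ = σ ∘ (x y z) for a path x – y – z in X. So FS(X,Y) has no
-- triangles, and a 4-cycle σ₀σ₁σ₂σ₃ yields two such walks from σ₀ to σ₂; if neither is
-- disjoint, both realise the same 3-cycle σ₀⁻¹σ₂ through different middle vertices, which
-- closes triangles in X and Y. Conversely two disjoint (hence commuting) swaps, or the
-- identity (a c)(a b) = (a b)(b c) on a triangle, close up into a 4-cycle once a bijection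
-- aligns the chosen edges of X with those of Y.
module Submission where

open import Defs hiding (sym)
open import Data.Nat using (ℕ; zero; suc; _<_; s≤s; z≤n)
open import Data.Fin using (Fin; zero; suc; inject₁)
open import Data.Fin.Properties using (_≟_)
open import Data.Fin.Permutation using (transpose)
import Data.Fin.Permutation.Components as PC
open import Data.Bool using (T)
open import Data.Empty using (⊥-elim)
open import Data.Product using (Σ; _×_; _,_; proj₁; proj₂; uncurry)
open import Data.Sum using (_⊎_; inj₁; inj₂; [_,_])
open import Function.Base using (_∘_)
open import Function.Bundles using (_⇔_; mk⇔; Bijection)
open import Function.Definitions using (Injective)
open import Function.Properties.Inverse using (Inverse⇒Bijection)
import Function.Construct.Composition as Comp
open import Relation.Binary.PropositionalEquality
  using (_≡_; _≢_; _≗_; refl; sym; trans; cong; subst; subst₂)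
open import Relation.Nullary using (¬_; Dec; yes; no; contradiction)
open import Relation.Nullary.Decidable using (dec-true; dec-false)

private
  variable
    n : ℕ
    a b c d p q r s : Fin n

≢-sym : a ≢ b → b ≢ a
≢-sym a≢b = a≢b ∘ sym

Edge-sym : (X : SimpleGraph n) → Edge X a b → Edge X b a
Edge-sym X = subst T (SimpleGraph.sym X _ _)

Edge⇒≢ : (X : SimpleGraph n) → Edge X a b → a ≢ b
Edge⇒≢ X e refl = subst T (irrefl X _) e

Edge-≡ : (X : SimpleGraph n) → p ≡ a → q ≡ b → Edge X a b → Edge X p q
Edge-≡ X p≡a q≡b = subst₂ (Edge X) (sym p≡a) (sym q≡b)

transpose-matchˡ : (i j : Fin n) → PC.transpose i j i ≡ j
transpose-matchˡ i j rewrite dec-true (i ≟ i) refl = refl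

transpose-matchʳ : (i j : Fin n) → PC.transpose i j j ≡ i
transpose-matchʳ i j with j ≟ i
... | yes j≡i = j≡i
... | no _ rewrite dec-true (j ≟ j) refl = refl

transpose-others : {i j k : Fin n} → k ≢ i → k ≢ j → PC.transpose i j k ≡ k
transpose-others {i = i} {j} {k} k≢i k≢j
  rewrite dec-false (k ≟ i) k≢i | dec-false (k ≟ j) k≢j = refl

transposeᴮ : Fin n → Fin n → Bij n
transposeᴮ i j = PC.transpose i j , Bijection.bijective (Inverse⇒Bijection (transpose i j))

infixr 9 _∘ᴮ_
_∘ᴮ_ : Bij n → Bij n → Bij n
(f , f-bij) ∘ᴮ (g , g-bij) = f ∘ g , Comp.bijective _≡_ _≡_ _≡_ g-bij f-bij

transpose-commute : a ≢ c → a ≢ d → b ≢ c → b ≢ d → (v : Fin n) →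
                    PC.transpose c d (PC.transpose a b v) ≡ PC.transpose a b (PC.transpose c d v)
transpose-commute {a = a} {c} {d} {b} a≢c a≢d b≢c b≢d v = by-cases (v ≟ a) (v ≟ b) (v ≟ c) (v ≟ d)
  where
  by-cases : Dec (v ≡ a) → Dec (v ≡ b) → Dec (v ≡ c) → Dec (v ≡ d) →
             PC.transpose c d (PC.transpose a b v) ≡ PC.transpose a b (PC.transpose c d v)
  by-cases (yes refl) _ _ _
    rewrite transpose-matchˡ v b | transpose-others b≢c b≢d
          | transpose-others a≢c a≢d | transpose-matchˡ v b = refl
  by-cases (no _) (yes refl) _ _
    rewrite transpose-matchʳ a v | transpose-others a≢c a≢d
          | transpose-others b≢c b≢d | transpose-matchʳ a v = refl
  by-cases (no v≢a) (no v≢b) (yes refl) _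
    rewrite transpose-others v≢a v≢b | transpose-matchˡ v d
          | transpose-others (≢-sym a≢d) (≢-sym b≢d) = refl
  by-cases (no v≢a) (no v≢b) (no _) (yes refl)
    rewrite transpose-others v≢a v≢b | transpose-matchʳ c v
          | transpose-others (≢-sym a≢c) (≢-sym b≢c) = refl
  by-cases (no v≢a) (no v≢b) (no v≢c) (no v≢d)
    rewrite transpose-others v≢a v≢b | transpose-others v≢c v≢d | transpose-others v≢a v≢b = refl

transpose-triangle : a ≢ b → b ≢ c → a ≢ c → (v : Fin n) →
                     PC.transpose a c (PC.transpose a b v) ≡ PC.transpose a b (PC.transpose b c v)
transpose-triangle {a = a} {b} {c} a≢b b≢c a≢c v = by-cases (v ≟ a) (v ≟ b) (v ≟ c)
  where
  by-cases : Dec (v ≡ a) → Dec (v ≡ b) → Dec (v ≡ c) →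
             PC.transpose a c (PC.transpose a b v) ≡ PC.transpose a b (PC.transpose b c v)
  by-cases (yes refl) _ _
    rewrite transpose-matchˡ v b | transpose-others (≢-sym a≢b) b≢c
          | transpose-others a≢b a≢c | transpose-matchˡ v b = refl
  by-cases (no _) (yes refl) _
    rewrite transpose-matchʳ a v | transpose-matchˡ a c
          | transpose-matchˡ v c | transpose-others (≢-sym a≢c) (≢-sym b≢c) = refl
  by-cases (no _) (no _) (yes refl)
    rewrite transpose-others (≢-sym a≢c) (≢-sym b≢c) | transpose-matchʳ a v
          | transpose-matchʳ b v | transpose-matchʳ a b = refl
  by-cases (no v≢a) (no v≢b) (no v≢c)
    rewrite transpose-others v≢a v≢b | transpose-others v≢a v≢c | transpose-others v≢b v≢c
          | transpose-others v≢a v≢b = refl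

redirect : Bij n → Fin n → Fin n → Bij n
redirect π x y = transposeᴮ (proj₁ π x) y ∘ᴮ π

redirect-sends : (π : Bij n) (x y : Fin n) → proj₁ (redirect π x y) x ≡ y
redirect-sends π x y = transpose-matchˡ (proj₁ π x) y

redirect-keeps : (π : Bij n) {w x y : Fin n} → proj₁ π w ≡ p → w ≢ x → p ≢ y → proj₁ (redirect π x y) w ≡ p
redirect-keeps (π , π-inj , _) πw≡p w≢x p≢y =
  trans (transpose-others (w≢x ∘ π-inj) (p≢y ∘ trans (sym πw≡p))) πw≡p

bijection-sending₃ : a ≢ b → b ≢ c → a ≢ c → p ≢ q → q ≢ r → p ≢ r →
                     Σ (Bij n) λ π → proj₁ π a ≡ p × proj₁ π b ≡ q × proj₁ π c ≡ r
bijection-sending₃ {a = a} {b} {c} {p} {q} {r} a≢b b≢c a≢c p≢q q≢r p≢r =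
  π₃ , redirect-keeps π₂ π₂a a≢c p≢r , redirect-keeps π₂ (redirect-sends π₁ b q) b≢c q≢r ,
  redirect-sends π₂ c r
  where
  π₁ = transposeᴮ a p
  π₂ = redirect π₁ b q
  π₃ = redirect π₂ c r
  π₂a : proj₁ π₂ a ≡ p
  π₂a = redirect-keeps π₁ (transpose-matchˡ a p) a≢b p≢q

bijection-sending₄ : a ≢ b → b ≢ c → a ≢ c → a ≢ d → b ≢ d → c ≢ d →
                     p ≢ q → q ≢ r → p ≢ r → p ≢ s → q ≢ s → r ≢ s →
                     Σ (Bij n) λ π → proj₁ π a ≡ p × proj₁ π b ≡ q × proj₁ π c ≡ r × proj₁ π d ≡ s
bijection-sending₄ {d = d} {s = s} a≢b b≢c a≢c a≢d b≢d c≢d p≢q q≢r p≢r p≢s q≢s r≢s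
  with bijection-sending₃ a≢b b≢c a≢c p≢q q≢r p≢r
... | π , πa , πb , πc =
  redirect π d s , redirect-keeps π πa a≢d p≢s , redirect-keeps π πb b≢d q≢s ,
  redirect-keeps π πc c≢d r≢s , redirect-sends π d s

≉-sym : {f g : Fin n → Fin n} → ¬ (f ≗ g) → ¬ (g ≗ f)
≉-sym f≉g g≗f = f≉g (sym ∘ g≗f)

≉-at : {f g : Fin n → Fin n} (v : Fin n) → f v ≡ p → g v ≡ q → p ≢ q → ¬ (f ≗ g)
≉-at v fv≡p gv≡q p≢q f≗g = p≢q (trans (sym fv≡p) (trans (f≗g v) gv≡q))

AgreeOff : (σ ρ : Fin n → Fin n) → Fin n → Fin n → Set
AgreeOff {n} σ ρ e f = ∀ (c : Fin n) → c ≢ e → c ≢ f → ρ c ≡ σ c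

record DiffersOnThree (σ ρ : Fin n → Fin n) : Set where
  constructor differs-at
  field
    i j k : Fin n
    i≢j : i ≢ j
    j≢k : j ≢ k
    i≢k : i ≢ k
    at-i : ρ i ≢ σ i
    at-j : ρ j ≢ σ j
    at-k : ρ k ≢ σ k

DiffersOnThree⇒¬AgreeOff : {σ ρ : Fin n → Fin n} → DiffersOnThree σ ρ → (e f : Fin n) → ¬ AgreeOff σ ρ e f
DiffersOnThree⇒¬AgreeOff (differs-at i j k i≢j j≢k i≢k at-i at-j at-k) e f agree with i ≟ e | i ≟ f
... | no i≢e | no i≢f = at-i (agree i i≢e i≢f)
... | yes refl | _ with j ≟ f
...   | no j≢f   = at-j (agree j (≢-sym i≢j) j≢f)
...   | yes refl = at-k (agree k (≢-sym i≢k) (≢-sym j≢k))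
DiffersOnThree⇒¬AgreeOff (differs-at i j k i≢j j≢k i≢k at-i at-j at-k) e f agree
  | no _ | yes refl with j ≟ e
...   | no j≢e   = at-j (agree j j≢e (≢-sym i≢j))
...   | yes refl = at-k (agree k (≢-sym j≢k) (≢-sym i≢k))

module _ (X Y : SimpleGraph n) where

  -- FSAdj X Y s t unfolds to  Σ a Σ b (SwapsAlong (proj₁ s) (proj₁ t) a b).
  SwapsAlong : (σ τ : Fin n → Fin n) → Fin n → Fin n → Set
  SwapsAlong σ τ a b = Edge X a b × Edge Y (σ a) (σ b) × τ a ≡ σ b × τ b ≡ σ a × AgreeOff σ τ a b

  SwapsAlong-flip : {σ τ : Fin n → Fin n} → SwapsAlong σ τ a b → SwapsAlong σ τ b a
  SwapsAlong-flip (ab , σaσb , τa , τb , τ-off) =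
    Edge-sym X ab , Edge-sym Y σaσb , τb , τa , λ c c≢b c≢a → τ-off c c≢a c≢b

  SwapsAlong-sym : {σ τ : Fin n → Fin n} → SwapsAlong σ τ a b → SwapsAlong τ σ a b
  SwapsAlong-sym (ab , σaσb , τa , τb , τ-off) =
    ab , Edge-≡ Y τa τb (Edge-sym Y σaσb) , sym τb , sym τa , λ c c≢a c≢b → sym (τ-off c c≢a c≢b)

  SwapsAlong-unique : {σ τ τ′ : Fin n → Fin n} → SwapsAlong σ τ a b → SwapsAlong σ τ′ a b → τ ≗ τ′
  SwapsAlong-unique {a = a} {b} (_ , _ , τa , τb , τ-off) (_ , _ , τ′a , τ′b , τ′-off) v
    with v ≟ a | v ≟ b
  ... | yes refl | _        = trans τa (sym τ′a)
  ... | no _     | yes refl = trans τb (sym τ′b)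
  ... | no v≢a   | no v≢b   = trans (τ-off v v≢a v≢b) (sym (τ′-off v v≢a v≢b))

  FSAdj-sym : (s t : Bij n) → FSAdj X Y s t → FSAdj X Y t s
  FSAdj-sym _ _ (a , b , swap) = a , b , SwapsAlong-sym swap

  FSAdj⇒≉ : (s t : Bij n) → FSAdj X Y s t → ¬ (proj₁ s ≗ proj₁ t)
  FSAdj⇒≉ (σ , σ-inj , _) _ (a , b , ab , _ , τa , _) σ≗τ = Edge⇒≢ X ab (σ-inj (trans (σ≗τ a) τa))

  DiffersOnThree⇒¬FSAdj : (s r : Bij n) → DiffersOnThree (proj₁ s) (proj₁ r) → ¬ FSAdj X Y s r
  DiffersOnThree⇒¬FSAdj _ _ D (e , f , _ , _ , _ , _ , r-off) = DiffersOnThree⇒¬AgreeOff D e f r-off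

  -- τ = σ ∘ (x y) and ρ = σ ∘ (x y z), where (x y z) is the 3-cycle x ↦ y ↦ z ↦ x.
  record Rotation (σ τ ρ : Fin n → Fin n) : Set where
    constructor rotation
    field
      x y z      : Fin n
      x≢z        : x ≢ z
      first-swap : SwapsAlong σ τ x y
      yz-edge    : Edge X y z
      σxσz-edge  : Edge Y (σ x) (σ z)
      ρx         : ρ x ≡ σ y
      ρy         : ρ y ≡ σ z
      ρz         : ρ z ≡ σ x
      ρ-off      : ∀ v → v ≢ x → v ≢ y → v ≢ z → ρ v ≡ σ v

  Rotation⇒DiffersOnThree : {σ τ ρ : Fin n → Fin n} → Injective _≡_ _≡_ σ →
                            Rotation σ τ ρ → DiffersOnThree σ ρ
  Rotation⇒DiffersOnThree σ-inj (rotation x y z x≢z (xy , _) yz _ ρx ρy ρz _) =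
    differs-at x y z x≢y y≢z x≢z
      (λ ρx≡σx → x≢y (σ-inj (trans (sym ρx≡σx) ρx)))
      (λ ρy≡σy → y≢z (σ-inj (trans (sym ρy≡σy) ρy)))
      (λ ρz≡σz → x≢z (sym (σ-inj (trans (sym ρz≡σz) ρz))))
    where
    x≢y = Edge⇒≢ X xy
    y≢z = Edge⇒≢ X yz

  rotation-of-shared-vertex : {σ τ ρ : Fin n → Fin n} →
    SwapsAlong σ τ a b → SwapsAlong τ ρ b d → ¬ (σ ≗ ρ) → Rotation σ τ ρ
  rotation-of-shared-vertex {a = a} {b} {d}
    first@(ab , _ , τa , τb , τ-off) second@(bd , τbτd , ρb , ρd , ρ-off) σ≉ρ with a ≟ d
  ... | yes refl = ⊥-elim (σ≉ρ (SwapsAlong-unique (SwapsAlong-flip (SwapsAlong-sym first)) second))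
  ... | no a≢d = rotation a b d a≢d first bd (Edge-≡ Y (sym τb) (sym τd) τbτd)
                   (trans (ρ-off a a≢b a≢d) τa) (trans ρb τd) (trans ρd τb)
                   (λ v v≢a v≢b v≢d → trans (ρ-off v v≢b v≢d) (τ-off v v≢a v≢b))
    where
    a≢b = Edge⇒≢ X ab
    τd = τ-off d (≢-sym a≢d) (≢-sym (Edge⇒≢ X bd))

  disjoint-swaps : {σ τ ρ : Fin n → Fin n} → Injective _≡_ _≡_ σ →
    SwapsAlong σ τ a b → SwapsAlong τ ρ c d → a ≢ c → a ≢ d → b ≢ c → b ≢ d →
    DiffersOnThree σ ρ × HasTwoDisjointEdges X × HasTwoDisjointEdges Y
  disjoint-swaps {a = a} {b} {c} {d} {σ} {τ} σ-inj (ab , σaσb , τa , τb , τ-off)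
    (cd , τcτd , ρc , ρd , ρ-off) a≢c a≢d b≢c b≢d =
    differs-at a b c a≢b b≢c a≢c
      (λ ρa≡σa → a≢b (σ-inj (trans (sym ρa≡σa) (trans (ρ-off a a≢c a≢d) τa))))
      (λ ρb≡σb → a≢b (sym (σ-inj (trans (sym ρb≡σb) (trans (ρ-off b b≢c b≢d) τb)))))
      (λ ρc≡σc → Edge⇒≢ X cd (σ-inj (trans (sym ρc≡σc) (trans ρc τd)))) ,
    (a , b , c , d , ab , cd , a≢c , a≢d , b≢c , b≢d) ,
    (σ a , σ b , τ c , τ d , σaσb , τcτd ,
      σ-separates a≢c τc , σ-separates a≢d τd , σ-separates b≢c τc , σ-separates b≢d τd)
    where
    a≢b = Edge⇒≢ X ab
    τc = τ-off c (≢-sym a≢c) (≢-sym b≢c)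
    τd = τ-off d (≢-sym a≢d) (≢-sym b≢d)
    σ-separates : ∀ {u v} → u ≢ v → τ v ≡ σ v → σ u ≢ τ v
    σ-separates u≢v τv σu≡τv = u≢v (σ-inj (trans σu≡τv τv))

  TwoStep : (σ τ ρ : Fin n → Fin n) → Set
  TwoStep σ τ ρ =
    (DiffersOnThree σ ρ × HasTwoDisjointEdges X × HasTwoDisjointEdges Y) ⊎ Rotation σ τ ρ

  TwoStep⇒DiffersOnThree : {σ τ ρ : Fin n → Fin n} → Injective _≡_ _≡_ σ →
                           TwoStep σ τ ρ → DiffersOnThree σ ρ
  TwoStep⇒DiffersOnThree _     (inj₁ (D , _)) = D
  TwoStep⇒DiffersOnThree σ-inj (inj₂ R)       = Rotation⇒DiffersOnThree σ-inj R

  two-step : (s t r : Bij n) → FSAdj X Y s t → FSAdj X Y t r → ¬ (proj₁ s ≗ proj₁ r) →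
             TwoStep (proj₁ s) (proj₁ t) (proj₁ r)
  two-step (_ , σ-inj , _) _ _ (a , b , first) (c , d , second) σ≉ρ
    with b ≟ c | b ≟ d | a ≟ c | a ≟ d
  ... | yes refl | _ | _ | _ =
    inj₂ (rotation-of-shared-vertex first second σ≉ρ)
  ... | no _ | yes refl | _ | _ =
    inj₂ (rotation-of-shared-vertex first (SwapsAlong-flip second) σ≉ρ)
  ... | no _ | no _ | yes refl | _ =
    inj₂ (rotation-of-shared-vertex (SwapsAlong-flip first) second σ≉ρ)
  ... | no _ | no _ | no _ | yes refl =
    inj₂ (rotation-of-shared-vertex (SwapsAlong-flip first) (SwapsAlong-flip second) σ≉ρ)
  ... | no b≢c | no b≢d | no a≢c | no a≢d =
    inj₁ (disjoint-swaps σ-inj first second a≢c a≢d b≢c b≢d)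

  FS-triangle-free : ¬ Cycle (FS X Y) 2
  FS-triangle-free C =
    DiffersOnThree⇒¬FSAdj σ₀ σ₂
      (TwoStep⇒DiffersOnThree (proj₁ (proj₂ σ₀)) (two-step σ₀ σ₁ σ₂ (step zero) (step (suc zero)) σ₀≉σ₂))
      (FSAdj-sym σ₂ σ₀ close)
    where
    open Cycle C
    σ₀ = vtx zero
    σ₁ = vtx (suc zero)
    σ₂ = vtx (suc (suc zero))
    σ₀≉σ₂ = distinct zero (suc (suc zero)) (λ ())

  -- Both rotations are the same 3-cycle σ⁻¹ρ, so (x′ y′ z′) is a rotation of (x y z);
  -- the trivial rotation would force τ = τ′, and the other two supply the missing edges.
  rotations⇒K3 : {σ τ τ′ ρ : Fin n → Fin n} → Injective _≡_ _≡_ σ →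
    Rotation σ τ ρ → Rotation σ τ′ ρ → ¬ (τ ≗ τ′) → ContainsK3 X × ContainsK3 Y
  rotations⇒K3 σ-inj (rotation x y z _ first _ _ ρx _ _ _)
    (rotation x′ y′ z′ _ first′ _ _ ρx′ _ _ _) τ≉τ′
    with x′ ≟ x | x′ ≟ y | x′ ≟ z
  ... | yes refl | _ | _ with σ-inj (trans (sym ρx′) ρx)
  ...   | refl = ⊥-elim (τ≉τ′ (SwapsAlong-unique first first′))
  rotations⇒K3 {σ = σ} σ-inj (rotation x y z _ first yz σxσz _ ρy ρz _)
    (rotation x′ y′ z′ _ first′ yz′ _ ρx′ ρy′ _ _) _
    | no _ | yes refl | _ with σ-inj (trans (sym ρx′) ρy)
  ...   | refl with σ-inj (trans (sym ρy′) ρz)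
  ...     | refl = (x , y , z , proj₁ first , yz , Edge-sym X yz′) ,
                   (σ x , σ y , σ z , proj₁ (proj₂ first) , proj₁ (proj₂ first′) , σxσz)
  rotations⇒K3 {σ = σ} σ-inj (rotation x y z _ first yz σxσz ρx _ ρz _)
    (rotation x′ y′ z′ _ first′ _ σx′σz′ ρx′ ρy′ _ _) _
    | no _ | no _ | yes refl with σ-inj (trans (sym ρx′) ρz)
  ...   | refl with σ-inj (trans (sym ρy′) ρx)
  ...     | refl = (x , y , z , proj₁ first , yz , Edge-sym X (proj₁ first′)) ,
                   (σ x , σ y , σ z , proj₁ (proj₂ first) , Edge-sym Y σx′σz′ , σxσz)
  rotations⇒K3 σ-inj (rotation x y z _ _ _ _ _ _ _ ρ-off)
    (rotation x′ y′ z′ _ first′ _ _ ρx′ _ _ _) _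
    | no x′≢x | no x′≢y | no x′≢z =
    ⊥-elim (Edge⇒≢ X (proj₁ first′) (σ-inj (trans (sym (ρ-off x′ x′≢x x′≢y x′≢z)) ρx′)))

  4-cycle⇒disjoint-or-K3 : Cycle (FS X Y) 3 →
    (HasTwoDisjointEdges X × HasTwoDisjointEdges Y) ⊎ (ContainsK3 X × ContainsK3 Y)
  4-cycle⇒disjoint-or-K3 C
    with two-step σ₀ σ₁ σ₂ (step zero) (step (suc zero)) σ₀≉σ₂
       | two-step σ₀ σ₃ σ₂ (FSAdj-sym σ₃ σ₀ close) (FSAdj-sym σ₂ σ₃ (step (suc (suc zero)))) σ₀≉σ₂
    where
    open Cycle C
    σ₀ = vtx zero
    σ₁ = vtx (suc zero)
    σ₂ = vtx (suc (suc zero))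
    σ₃ = vtx (suc (suc (suc zero)))
    σ₀≉σ₂ = distinct zero (suc (suc zero)) (λ ())
  ... | inj₁ (_ , disjoint) | _                   = inj₁ disjoint
  ... | inj₂ _              | inj₁ (_ , disjoint) = inj₁ disjoint
  ... | inj₂ R              | inj₂ R′             =
    inj₂ (rotations⇒K3 (proj₁ (proj₂ (Cycle.vtx C zero))) R R′
           (Cycle.distinct C (suc zero) (suc (suc (suc zero))) (λ ())))

  FSAdj-transpose : (s t : Bij n) → Edge X a b → Edge Y (proj₁ s a) (proj₁ s b) →
    (∀ v → proj₁ t v ≡ proj₁ s (PC.transpose a b v)) → FSAdj X Y s t
  FSAdj-transpose {a = a} {b} (σ , _) _ ab σaσb t≗σ∘ab =
    a , b , ab , σaσb ,
    trans (t≗σ∘ab a) (cong σ (transpose-matchˡ a b)) ,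
    trans (t≗σ∘ab b) (cong σ (transpose-matchʳ a b)) ,
    λ c c≢a c≢b → trans (t≗σ∘ab c) (cong σ (transpose-others c≢a c≢b))

  FS-square : (σ₀ σ₁ σ₂ σ₃ : Bij n) →
    FSAdj X Y σ₀ σ₁ → FSAdj X Y σ₁ σ₂ → FSAdj X Y σ₂ σ₃ → FSAdj X Y σ₃ σ₀ →
    ¬ (proj₁ σ₀ ≗ proj₁ σ₂) → ¬ (proj₁ σ₁ ≗ proj₁ σ₃) → Cycle (FS X Y) 3
  FS-square σ₀ σ₁ σ₂ σ₃ e₀₁ e₁₂ e₂₃ e₃₀ σ₀≉σ₂ σ₁≉σ₃ = record
    { len≥3    = s≤s (s≤s z≤n)
    ; vtx      = vtx
    ; distinct = distinct
    ; step     = step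
    ; close    = e₃₀
    }
    where
    vtx : Fin 4 → Bij n
    vtx zero                   = σ₀
    vtx (suc zero)             = σ₁
    vtx (suc (suc zero))       = σ₂
    vtx (suc (suc (suc zero))) = σ₃

    step : (i : Fin 3) → FSAdj X Y (vtx (inject₁ i)) (vtx (suc i))
    step zero             = e₀₁
    step (suc zero)       = e₁₂
    step (suc (suc zero)) = e₂₃

    σ₀≉σ₁ = FSAdj⇒≉ σ₀ σ₁ e₀₁
    σ₁≉σ₂ = FSAdj⇒≉ σ₁ σ₂ e₁₂
    σ₂≉σ₃ = FSAdj⇒≉ σ₂ σ₃ e₂₃
    σ₃≉σ₀ = FSAdj⇒≉ σ₃ σ₀ e₃₀

    distinct : ∀ i j → i ≢ j → ¬ (proj₁ (vtx i) ≗ proj₁ (vtx j))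
    distinct zero                   zero                   i≢i = ⊥-elim (i≢i refl)
    distinct zero                   (suc zero)             _   = σ₀≉σ₁
    distinct zero                   (suc (suc zero))       _   = σ₀≉σ₂
    distinct zero                   (suc (suc (suc zero))) _   = ≉-sym σ₃≉σ₀
    distinct (suc zero)             zero                   _   = ≉-sym σ₀≉σ₁
    distinct (suc zero)             (suc zero)             i≢i = ⊥-elim (i≢i refl)
    distinct (suc zero)             (suc (suc zero))       _   = σ₁≉σ₂
    distinct (suc zero)             (suc (suc (suc zero))) _   = σ₁≉σ₃
    distinct (suc (suc zero))       zero                   _   = ≉-sym σ₀≉σ₂
    distinct (suc (suc zero))       (suc zero)             _   = ≉-sym σ₁≉σ₂
    distinct (suc (suc zero))       (suc (suc zero))       i≢i = ⊥-elim (i≢i refl)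
    distinct (suc (suc zero))       (suc (suc (suc zero))) _   = σ₂≉σ₃
    distinct (suc (suc (suc zero))) zero                   _   = σ₃≉σ₀
    distinct (suc (suc (suc zero))) (suc zero)             _   = ≉-sym σ₁≉σ₃
    distinct (suc (suc (suc zero))) (suc (suc zero))       _   = ≉-sym σ₂≉σ₃
    distinct (suc (suc (suc zero))) (suc (suc (suc zero))) i≢i = ⊥-elim (i≢i refl)

  disjoint-swaps-square : (π : Bij n) → Edge X a b → Edge X c d → a ≢ c → a ≢ d → b ≢ c → b ≢ d →
    Edge Y (proj₁ π a) (proj₁ π b) → Edge Y (proj₁ π c) (proj₁ π d) → Cycle (FS X Y) 3
  disjoint-swaps-square {a = a} {b} {c} {d} π@(f , _) ab cd a≢c a≢d b≢c b≢d fafb fcfd =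
    FS-square π σ₁ σ₂ σ₃
      (FSAdj-transpose π σ₁ ab fafb (λ _ → refl))
      (FSAdj-transpose σ₁ σ₂ cd (Edge-≡ Y σ₁c σ₁d fcfd) (λ _ → refl))
      (FSAdj-sym σ₃ σ₂ (FSAdj-transpose σ₃ σ₂ ab (Edge-≡ Y σ₃a σ₃b fafb)
        (λ v → cong f (sym (transpose-commute a≢c a≢d b≢c b≢d v)))))
      (FSAdj-sym π σ₃ (FSAdj-transpose π σ₃ cd fcfd (λ _ → refl)))
      (≉-at a refl σ₂a (Edge⇒≢ Y fafb))
      (≉-at a σ₁a σ₃a (≢-sym (Edge⇒≢ Y fafb)))
    where
    σ₁ = π ∘ᴮ transposeᴮ a b
    σ₂ = σ₁ ∘ᴮ transposeᴮ c d
    σ₃ = π ∘ᴮ transposeᴮ c d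
    σ₁a = cong f (transpose-matchˡ a b)
    σ₁c = cong f (transpose-others (≢-sym a≢c) (≢-sym b≢c))
    σ₁d = cong f (transpose-others (≢-sym a≢d) (≢-sym b≢d))
    σ₂a = trans (cong (proj₁ σ₁) (transpose-others a≢c a≢d)) σ₁a
    σ₃a = cong f (transpose-others a≢c a≢d)
    σ₃b = cong f (transpose-others b≢c b≢d)

  triangle-square : (π : Bij n) → Edge X a b → Edge X b c → Edge X a c →
    Edge Y (proj₁ π a) (proj₁ π b) → Edge Y (proj₁ π b) (proj₁ π c) → Edge Y (proj₁ π a) (proj₁ π c) →
    Cycle (FS X Y) 3
  triangle-square {a = a} {b} {c} π@(f , _) ab bc ac fafb fbfc fafc =
    FS-square π σ₁ σ₂ σ₃
      (FSAdj-transpose π σ₁ ab fafb (λ _ → refl))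
      (FSAdj-transpose σ₁ σ₂ bc (Edge-≡ Y σ₁b σ₁c fafc) (λ _ → refl))
      (FSAdj-sym σ₃ σ₂ (FSAdj-transpose σ₃ σ₂ ab (Edge-≡ Y σ₃a σ₃b (Edge-sym Y fbfc))
        (λ v → cong f (sym (transpose-triangle a≢b b≢c a≢c v)))))
      (FSAdj-sym π σ₃ (FSAdj-transpose π σ₃ ac fafc (λ _ → refl)))
      (≉-at a refl σ₂a (Edge⇒≢ Y fafb))
      (≉-at a σ₁a σ₃a (Edge⇒≢ Y fbfc))
    where
    a≢b = Edge⇒≢ X ab
    b≢c = Edge⇒≢ X bc
    a≢c = Edge⇒≢ X ac
    σ₁ = π ∘ᴮ transposeᴮ a b
    σ₂ = σ₁ ∘ᴮ transposeᴮ b c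
    σ₃ = π ∘ᴮ transposeᴮ a c
    σ₁a = cong f (transpose-matchˡ a b)
    σ₁b = cong f (transpose-matchʳ a b)
    σ₁c = cong f (transpose-others (≢-sym a≢c) (≢-sym b≢c))
    σ₂a = trans (cong (proj₁ σ₁) (transpose-others a≢b a≢c)) σ₁a
    σ₃a = cong f (transpose-matchˡ a c)
    σ₃b = cong f (transpose-others (≢-sym a≢b) b≢c)

  disjoint-edges⇒4-cycle : HasTwoDisjointEdges X → HasTwoDisjointEdges Y → Cycle (FS X Y) 3
  disjoint-edges⇒4-cycle (a , b , c , d , ab , cd , a≢c , a≢d , b≢c , b≢d)
                         (p , q , r , s , pq , rs , p≢r , p≢s , q≢r , q≢s)
    with bijection-sending₄ (Edge⇒≢ X ab) b≢c a≢c a≢d b≢d (Edge⇒≢ X cd)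
                            (Edge⇒≢ Y pq) q≢r p≢r p≢s q≢s (Edge⇒≢ Y rs)
  ... | π , πa , πb , πc , πd =
    disjoint-swaps-square π ab cd a≢c a≢d b≢c b≢d (Edge-≡ Y πa πb pq) (Edge-≡ Y πc πd rs)

  K3⇒4-cycle : ContainsK3 X → ContainsK3 Y → Cycle (FS X Y) 3
  K3⇒4-cycle (a , b , c , ab , bc , ac) (p , q , r , pq , qr , pr)
    with bijection-sending₃ (Edge⇒≢ X ab) (Edge⇒≢ X bc) (Edge⇒≢ X ac)
                            (Edge⇒≢ Y pq) (Edge⇒≢ Y qr) (Edge⇒≢ Y pr)
  ... | π , πa , πb , πc =
    triangle-square π ab bc ac (Edge-≡ Y πa πb pq) (Edge-≡ Y πb πc qr) (Edge-≡ Y πa πc pr)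

  FS-no-short-cycles : ∀ j → j < 4 → ¬ HasCycleOfLength (FS X Y) j
  FS-no-short-cycles zero                   _ ()
  FS-no-short-cycles (suc zero)             _ C = contradiction (Cycle.len≥3 C) λ ()
  FS-no-short-cycles (suc (suc zero))       _ C = contradiction (Cycle.len≥3 C) λ { (s≤s ()) }
  FS-no-short-cycles (suc (suc (suc zero))) _ C = FS-triangle-free C
  FS-no-short-cycles (suc (suc (suc (suc _)))) (s≤s (s≤s (s≤s (s≤s ()))))

proposition4p1 : ∀ (n : ℕ) (X Y : SimpleGraph n) →
    GirthIs (FS X Y) 4 ⇔
      ((HasTwoDisjointEdges X × HasTwoDisjointEdges Y) ⊎ (ContainsK3 X × ContainsK3 Y))
proposition4p1 n X Y =
  mk⇔ (4-cycle⇒disjoint-or-K3 X Y ∘ proj₁)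
      (λ h → [ uncurry (disjoint-edges⇒4-cycle X Y) , uncurry (K3⇒4-cycle X Y) ] h ,
             FS-no-short-cycles X Y)
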